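{- Let $g\ge1$, $n\ge1$, $F=\mathbb{F}_{2^n}$, and let $v\in F[x]$ be monic of degree at most $g+1$. Let $V=F[x]/(x^{2g+3})$ viewed as an $\mathbb{F}_2$-vector space, and $U=\{r v+r^2 : r\in F[x],\ \deg r\le g+1\}\subseteq V$. Then $\#(V/U)=2^{(g+1)n+1}$. -}

module Defs where

open import Level using (0ℓ)
open import Data.Nat using (ℕ; zero; suc; _+_; _*_; _∸_; _^_; _≤_; _<_; _<?_)
open import Data.Fin using (Fin; fromℕ<; toℕ)
open import Data.Product using (Σ; ∃; _×_; _,_)
open import Relation.Nullary using (¬_; yes; no)
open import Relation.Binary.PropositionalEquality using (_≡_)
open import Algebra.Structures using (IsCommutativeRing)
open import Function.Bundles using (_↔_)

record Field : Set₁ where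
  infixl 6 _+ᶠ_
  infixl 7 _*ᶠ_
  field
    Carrier : Set
    _+ᶠ_ _*ᶠ_ : Carrier → Carrier → Carrier
    -ᶠ_ : Carrier → Carrier
    0ᶠ 1ᶠ : Carrier
    isCommutativeRing : IsCommutativeRing _≡_ _+ᶠ_ _*ᶠ_ -ᶠ_ 0ᶠ 1ᶠ
    0≢1 : ¬ (0ᶠ ≡ 1ᶠ)
    inverse : ∀ x → ¬ (x ≡ 0ᶠ) → ∃ λ y → x *ᶠ y ≡ 1ᶠ

-- F is a finite field with exactly q elements (for q = 2^n this is F_{2^n},
-- unique up to isomorphism).
HasOrder : Field → ℕ → Set
HasOrder F q = Field.Carrier F ↔ Fin q

module Poly (F : Field) where
  open Field F

  Coeffs : Set
  Coeffs = ℕ → Carrier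

  sumTo : ℕ → (ℕ → Carrier) → Carrier
  sumTo zero    f = 0ᶠ
  sumTo (suc k) f = sumTo k f +ᶠ f k

  mulCoeff : Coeffs → Coeffs → Coeffs
  mulCoeff a b k = sumTo (suc k) (λ i → a i *ᶠ b (k ∸ i))

  fromVec : ∀ {m} → (Fin m → Carrier) → Coeffs
  fromVec {m} c k with k <? m
  ... | yes k<m = c (fromℕ< k<m)
  ... | no  _   = 0ᶠ

  monic : (d : ℕ) → (Fin d → Carrier) → Coeffs
  monic d c k with k <? d | k Data.Nat.≟ d
  ... | yes k<d | _      = c (fromℕ< k<d)
  ... | no _    | yes _  = 1ᶠ
  ... | no _    | no _   = 0ᶠ

  -- V = F[x]/(x^N), elements given by their N coefficients
  Quot : ℕ → Set
  Quot N = Fin N → Carrier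

  reduce : (N : ℕ) → Coeffs → Quot N
  reduce N a i = a (toℕ i)

  _-ᵛ_ : ∀ {N} → Quot N → Quot N → Quot N
  (a -ᵛ b) i = a i +ᶠ (-ᶠ b i)

module Setup (g : ℕ) (F : Field) (d : ℕ) (vc : Fin d → Field.Carrier F) where
  open Field F
  open Poly F public

  N : ℕ
  N = 2 * g + 3

  v : Coeffs
  v = monic d vc

  uElem : (Fin (suc (suc g)) → Carrier) → Quot N
  uElem rc = reduce N (λ k → mulCoeff r v k +ᶠ mulCoeff r r k)
    where r = fromVec rc

  InU : Quot N → Set
  InU w = ∃ λ rc → ∀ i → w i ≡ uElem rc i

  SameCoset : Quot N → Quot N → Set
  SameCoset a b = InU (a -ᵛ b)

-- #(V/U) = K: there is a surjection V → Fin K whose fibres are exactly the cosets of U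
QuotientHasSize : (g : ℕ) (F : Field) (d : ℕ) (vc : Fin d → Field.Carrier F) → ℕ → Set
QuotientHasSize g F d vc K =
  Σ (Quot N → Fin K) λ q →
    (∀ k → ∃ λ a → q a ≡ k) ×
    (∀ a b → (q a ≡ q b → SameCoset a b) × (SameCoset a b → q a ≡ q b))
  where open Setup g F d vc

{-# OPTIONS --safe #-}
module Submission where

-- Write d = deg v ≤ g + 1. A field with 2ⁿ elements has characteristic 2, so φ r = r v + r² is
-- additive and U is a subgroup of V. If deg r = i, then φ r vanishes beyond pivot i = max(i + d, 2i),
-- where its coefficient is rᵢ (i < d), ℘ r_d = r_d² + r_d (i = d) or rᵢ² (i > d). Working down
-- from i = g + 1, every w ∈ V can be moved within its coset until its g + 2 pivot coefficients
-- vanish, except the one at 2d, which can only be brought into {0, c} for a fixed c ∉ ℘ F (℘ is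
-- two-to-one, so ℘ F has index 2). These normal forms are unique: if φ r has normalised pivots,
-- then r ∈ {0, v} and φ r = 0. The other g + 1 of the 2g + 3 positions are free, so the cosets
-- correspond to F^(g+1) × {0, c}, and there are 2 · 2^((g+1)n) of them.

open import Defs
open import Algebra.Bundles using (CommutativeRing)
import Algebra.Properties.CommutativeMonoid.Sum as MonoidSum
import Algebra.Properties.CommutativeSemigroup as CommutativeSemigroupProperties
import Algebra.Properties.Ring as RingProperties
import Algebra.Properties.Semiring.Mult as SemiringMult
open import Data.Bool using (Bool; true; false)
open import Data.Empty using (⊥-elim)
open import Data.Fin as Fin using (Fin; punchOut)
import Data.Fin.Properties as FinP
open import Data.Nat as ℕ using (ℕ; zero; suc; _+_; _*_; _^_; _≤_; _<_; _∸_; _⊔_; z≤n; s≤s)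
import Data.Nat.Properties as ℕP
open import Data.Nat.Tactic.RingSolver using (solve-∀)
open import Data.Product as Product using (∃; _×_; _,_; proj₁; proj₂)
open import Data.Sum using (_⊎_; inj₁; inj₂)
open import Function.Base using (_∘_)
open import Function.Bundles using (_↔_; Inverse; Injection; mk↔ₛ′)
open import Function.Construct.Composition using (_↔-∘_)
open import Function.Construct.Symmetry using (↔-sym)
open import Function.Definitions using (Injective)
open import Function.Properties.Inverse using (↔⇒↣)
open import Level using (0ℓ)
open import Relation.Binary.Definitions using (tri<; tri≈; tri>)
open import Relation.Binary.PropositionalEquality
open import Relation.Nullary using (¬_; Dec; yes; no; contradiction; ¬?)
open import Relation.Nullary.Decidable using (map′; does; dec-true; dec-false)

data Parity : ℕ → Set where
  even : ∀ h → Parity (h + h)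
  odd  : ∀ h → Parity (suc (h + h))

parity : ∀ k → Parity k
parity zero = even 0
parity (suc zero) = odd 0
parity (suc (suc k)) with parity k
... | even h = subst Parity (cong suc (ℕP.+-suc h h)) (even (suc h))
... | odd h = subst Parity (cong (λ n → suc (suc n)) (ℕP.+-suc h h)) (odd (suc h))

m+m<n+n⇒m<n : ∀ {m n} → m + m < n + n → m < n
m+m<n+n⇒m<n m+m<n+n = ℕP.≰⇒> (λ n≤m → ℕP.<⇒≱ m+m<n+n (ℕP.+-mono-≤ n≤m n≤m))

<-mono⇒injective : ∀ {f : ℕ → ℕ} → (∀ {i j} → i < j → f i < f j) → Injective _≡_ _≡_ f
<-mono⇒injective f-mono {i} {j} fi≡fj with ℕP.<-cmp i j
... | tri< i<j _ _ = contradiction fi≡fj (ℕP.<⇒≢ (f-mono i<j))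
... | tri≈ _ i≡j _ = i≡j
... | tri> _ _ j<i = contradiction (sym fi≡fj) (ℕP.<⇒≢ (f-mono j<i))

m+m≤n+n⇒m≤n : ∀ {m n} → m + m ≤ n + n → m ≤ n
m+m≤n+n⇒m≤n {m} {n} le = subst₂ _≤_ (sym (ℕP.n≡⌊n+n/2⌋ m)) (sym (ℕP.n≡⌊n+n/2⌋ n)) (ℕP.⌊n/2⌋-mono le)

m+m≤1+n+n⇒m≤n : ∀ {m n} → m + m ≤ suc (n + n) → m ≤ n
m+m≤1+n+n⇒m≤n {m} {n} le = subst₂ _≤_ (sym (ℕP.n≡⌊n+n/2⌋ m)) (sym (ℕP.n≡⌈n+n/2⌉ n)) (ℕP.⌊n/2⌋-mono le)

m+m≢1+n+n : ∀ {m n} → m + m ≢ suc (n + n)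
m+m≢1+n+n {m} {n} eq = ℕP.1+n≢n (sym (subst (λ h → h + h ≡ suc (n + n)) m≡n eq))
  where
  m≡n : m ≡ n
  m≡n = trans (ℕP.n≡⌊n+n/2⌋ m) (trans (cong ℕ.⌊_/2⌋ eq) (sym (ℕP.n≡⌈n+n/2⌉ n)))

Fin-injective⇒surjective : ∀ {m} (f : Fin m → Fin m) → Injective _≡_ _≡_ f → ∀ y → ∃ λ x → f x ≡ y
Fin-injective⇒surjective {suc m} f f-inj y with FinP.any? (λ x → f x FinP.≟ y)
... | yes hit = hit
... | no ¬hit = ⊥-elim (FinP.<⇒notInjective (ℕP.n<1+n m) squeezed-injective)
  where
  y≢f : ∀ x → y ≢ f x
  y≢f x y≡fx = ¬hit (x , sym y≡fx)
  squeezed-injective : Injective _≡_ _≡_ (λ x → punchOut (y≢f x))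
  squeezed-injective eq = f-inj (FinP.punchOut-injective (y≢f _) (y≢f _) eq)

module FiniteType {A : Set} {m : ℕ} (A↔Fin : A ↔ Fin m) where
  open Inverse A↔Fin using (to; from; strictlyInverseˡ; strictlyInverseʳ)

  to-injective : Injective _≡_ _≡_ to
  to-injective = Injection.injective (↔⇒↣ A↔Fin)

  from-injective : Injective _≡_ _≡_ from
  from-injective {i} {j} eq = trans (sym (strictlyInverseˡ i)) (trans (cong to eq) (strictlyInverseˡ j))

  _≟_ : (x y : A) → Dec (x ≡ y)
  _≟_ = FinP.inj⇒≟ (↔⇒↣ A↔Fin)

  injective⇒surjective : (f : A → A) → Injective _≡_ _≡_ f → ∀ y → ∃ λ x → f x ≡ y
  injective⇒surjective f f-inj y
    with x , fx≡y ← Fin-injective⇒surjective (to ∘ f ∘ from) (from-injective ∘ f-inj ∘ to-injective) (to y)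
    = from x , to-injective fx≡y

  surjective⇒injective : (f : A → A) → (∀ y → ∃ λ x → f x ≡ y) → Injective _≡_ _≡_ f
  surjective⇒injective f f-surj {x} {x′} fx≡fx′ =
    trans (sym (section∘f x)) (trans (cong section fx≡fx′) (section∘f x′))
    where
    section : A → A
    section y = proj₁ (f-surj y)
    section-injective : Injective _≡_ _≡_ section
    section-injective {y} {y′} eq = trans (sym (f-surj y .proj₂)) (trans (cong f eq) (f-surj y′ .proj₂))
    section-surjective : ∀ x → ∃ λ y → section y ≡ x
    section-surjective = injective⇒surjective section section-injective
    section∘f : ∀ x → section (f x) ≡ x
    section∘f x with y , refl ← section-surjective x = cong section (f-surj y .proj₂)

  preimage? : (f : A → A) → ∀ y → Dec (∃ λ x → f x ≡ y)
  preimage? f y = map′ (λ (i , p) → from i , p) (λ (x , p) → to x , trans (cong f (strictlyInverseʳ x)) p)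
                       (FinP.any? (λ i → f (from i) ≟ y))

  ¬injective⇒missesValue : (f : A → A) → ¬ Injective _≡_ _≡_ f → ∃ λ y → ∀ x → f x ≢ y
  ¬injective⇒missesValue f ¬inj with FinP.any? (λ i → ¬? (preimage? f (from i)))
  ... | yes (i , missed) = from i , λ x fx≡y → missed (x , fx≡y)
  ... | no ¬missed = ⊥-elim (¬inj (surjective⇒injective f hit))
    where
    hit : ∀ y → ∃ λ x → f x ≡ y
    hit y with preimage? f y
    ... | yes found = found
    ... | no ¬found = ⊥-elim (¬missed (to y , subst (λ z → ¬ (∃ λ x → f x ≡ z)) (sym (strictlyInverseʳ y)) ¬found))

funToFin-cong : ∀ {m n} {f g : Fin m → Fin n} → (∀ i → f i ≡ g i) → Fin.funToFin f ≡ Fin.funToFin g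
funToFin-cong {zero} _ = refl
funToFin-cong {suc m} f≗g = cong₂ Fin.combine (f≗g Fin.zero) (funToFin-cong (f≗g ∘ Fin.suc))

module Encoding {A : Set} {m : ℕ} (A↔Fin : A ↔ Fin m) (G : ℕ) where
  open Inverse A↔Fin using (to; from; strictlyInverseˡ; strictlyInverseʳ)
  open Inverse FinP.2↔Bool using ()
    renaming ( to to finToBool; from to boolToFin
             ; strictlyInverseˡ to finToBool∘boolToFin; strictlyInverseʳ to boolToFin∘finToBool )

  Code : Set
  Code = Bool × (Fin G → A)

  -- a record, so that checking x ≈ y never unfolds x and y
  record _≈_ (x y : Code) : Set where
    constructor mk≈
    field
      same-bit : proj₁ x ≡ proj₁ y
      same-fun : ∀ j → proj₂ x j ≡ proj₂ y j

  ≈-trans : ∀ {x y z} → x ≈ y → y ≈ z → x ≈ z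
  ≈-trans (mk≈ b≡b′ t≗t′) (mk≈ b′≡b″ t′≗t″) =
    mk≈ (trans b≡b′ b′≡b″) (λ j → trans (t≗t′ j) (t′≗t″ j))

  ≈-sym : ∀ {x y} → x ≈ y → y ≈ x
  ≈-sym (mk≈ b≡b′ t≗t′) = mk≈ (sym b≡b′) (λ j → sym (t≗t′ j))

  encode : Code → Fin (2 * m ^ G)
  encode (b , t) = Fin.combine (boolToFin b) (Fin.funToFin (to ∘ t))

  decodePair : Fin 2 × Fin (m ^ G) → Code
  decodePair (i , k) = finToBool i , from ∘ Fin.finToFun {m} {G} k

  decode : Fin (2 * m ^ G) → Code
  decode z = decodePair (Fin.remQuot {2} (m ^ G) z)

  encode-cong : ∀ {x y} → x ≈ y → encode x ≡ encode y
  encode-cong {b , _} (mk≈ refl t≗t′) = cong (Fin.combine (boolToFin b)) (funToFin-cong (cong to ∘ t≗t′))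

  decode-encode : ∀ x → decode (encode x) ≈ x
  decode-encode (b , t) =
    subst (_≈ (b , t)) (cong decodePair (sym (FinP.remQuot-combine (boolToFin b) (Fin.funToFin (to ∘ t)))))
          (mk≈ (finToBool∘boolToFin b)
               (λ j → trans (cong from (FinP.finToFun-funToFin (to ∘ t) j)) (strictlyInverseʳ (t j))))

  encode-decode : ∀ z → encode (decode z) ≡ z
  encode-decode z =
    trans (cong₂ Fin.combine (boolToFin∘finToBool i)
                             (trans (funToFin-cong (strictlyInverseˡ ∘ Fin.finToFun {m} {G} k))
                                    (FinP.funToFin-finToFin {G} {m} k)))
          (FinP.combine-remQuot (m ^ G) z)
    where
    i = proj₁ (Fin.remQuot {2} (m ^ G) z)
    k = proj₂ (Fin.remQuot {2} (m ^ G) z)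

  encode-injective : ∀ {x y} → encode x ≡ encode y → x ≈ y
  encode-injective {x} {y} eq = ≈-trans (≈-sym (decode-encode x)) (subst (λ z → decode z ≈ y) (sym eq) (decode-encode y))

module FieldProperties (F : Field) where
  open Field F public using (Carrier; _+ᶠ_; _*ᶠ_; -ᶠ_; 0ᶠ; 1ᶠ; 0≢1; inverse)

  ring : CommutativeRing 0ℓ 0ℓ
  ring = record { isCommutativeRing = Field.isCommutativeRing F }

  open CommutativeRing ring public
    using ( +-assoc; +-comm; +-identityˡ; +-identityʳ; *-assoc; *-comm; *-identityˡ; *-identityʳ
          ; distribˡ; distribʳ; zeroˡ; zeroʳ )
  open CommutativeSemigroupProperties (CommutativeRing.+-commutativeSemigroup ring) public
    renaming (interchange to +-interchange) using ()
  open RingProperties (CommutativeRing.ring ring) public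
    using (+-cancelˡ; +-cancelʳ; +-identityʳ-unique; +-inverseʳ-unique)

  x*y≡0⇒y≡0 : ∀ {x y} → x ≢ 0ᶠ → x *ᶠ y ≡ 0ᶠ → y ≡ 0ᶠ
  x*y≡0⇒y≡0 {x} {y} x≢0 xy≡0 with x⁻¹ , xx⁻¹≡1 ← inverse x x≢0 = begin
    y                ≡⟨ sym (*-identityˡ y) ⟩
    1ᶠ *ᶠ y          ≡⟨ cong (_*ᶠ y) (sym xx⁻¹≡1) ⟩
    (x *ᶠ x⁻¹) *ᶠ y  ≡⟨ cong (_*ᶠ y) (*-comm x x⁻¹) ⟩
    (x⁻¹ *ᶠ x) *ᶠ y  ≡⟨ *-assoc x⁻¹ x y ⟩
    x⁻¹ *ᶠ (x *ᶠ y)  ≡⟨ cong (x⁻¹ *ᶠ_) xy≡0 ⟩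
    x⁻¹ *ᶠ 0ᶠ        ≡⟨ zeroʳ x⁻¹ ⟩
    0ᶠ               ∎
    where open ≡-Reasoning

  module Characteristic2 (1+1≡0 : 1ᶠ +ᶠ 1ᶠ ≡ 0ᶠ) where
    x+x≡0 : ∀ x → x +ᶠ x ≡ 0ᶠ
    x+x≡0 x = begin
      x +ᶠ x              ≡⟨ cong₂ _+ᶠ_ (sym (*-identityʳ x)) (sym (*-identityʳ x)) ⟩
      x *ᶠ 1ᶠ +ᶠ x *ᶠ 1ᶠ  ≡⟨ sym (distribˡ x 1ᶠ 1ᶠ) ⟩
      x *ᶠ (1ᶠ +ᶠ 1ᶠ)     ≡⟨ cong (x *ᶠ_) 1+1≡0 ⟩
      x *ᶠ 0ᶠ             ≡⟨ zeroʳ x ⟩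
      0ᶠ                  ∎
      where open ≡-Reasoning

    -x≡x : ∀ x → -ᶠ x ≡ x
    -x≡x x = sym (+-inverseʳ-unique x x (x+x≡0 x))

    x+y≡0⇒x≡y : ∀ {x y} → x +ᶠ y ≡ 0ᶠ → x ≡ y
    x+y≡0⇒x≡y {x} {y} x+y≡0 = sym (trans (+-inverseʳ-unique x y x+y≡0) (-x≡x x))

    x+[x+y]≡y : ∀ x y → x +ᶠ (x +ᶠ y) ≡ y
    x+[x+y]≡y x y = trans (sym (+-assoc x x y)) (trans (cong (_+ᶠ y) (x+x≡0 x)) (+-identityˡ y))

    x≡y⇒x+y≡0 : ∀ {x y} → x ≡ y → x +ᶠ y ≡ 0ᶠ
    x≡y⇒x+y≡0 {x} refl = x+x≡0 x

    x+y≡z+w⇒x+z≡y+w : ∀ {x y z w} → x +ᶠ y ≡ z +ᶠ w → x +ᶠ z ≡ y +ᶠ w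
    x+y≡z+w⇒x+z≡y+w {x} {y} {z} {w} eq = x+y≡0⇒x≡y (trans (+-interchange x z y w) (x≡y⇒x+y≡0 eq))

    square-+ : ∀ x y → (x +ᶠ y) *ᶠ (x +ᶠ y) ≡ x *ᶠ x +ᶠ y *ᶠ y
    square-+ x y = begin
      (x +ᶠ y) *ᶠ (x +ᶠ y)                      ≡⟨ distribʳ (x +ᶠ y) x y ⟩
      x *ᶠ (x +ᶠ y) +ᶠ y *ᶠ (x +ᶠ y)            ≡⟨ cong₂ _+ᶠ_ (distribˡ x x y) (trans (distribˡ y x y) (+-comm _ _)) ⟩
      (x *ᶠ x +ᶠ x *ᶠ y) +ᶠ (y *ᶠ y +ᶠ y *ᶠ x)  ≡⟨ +-interchange _ _ _ _ ⟩
      (x *ᶠ x +ᶠ y *ᶠ y) +ᶠ (x *ᶠ y +ᶠ y *ᶠ x)  ≡⟨ cong (λ z → x *ᶠ x +ᶠ y *ᶠ y +ᶠ (x *ᶠ y +ᶠ z)) (*-comm y x) ⟩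
      x *ᶠ x +ᶠ y *ᶠ y +ᶠ (x *ᶠ y +ᶠ x *ᶠ y)    ≡⟨ cong (x *ᶠ x +ᶠ y *ᶠ y +ᶠ_) (x+x≡0 (x *ᶠ y)) ⟩
      x *ᶠ x +ᶠ y *ᶠ y +ᶠ 0ᶠ                    ≡⟨ +-identityʳ _ ⟩
      x *ᶠ x +ᶠ y *ᶠ y                          ∎
      where open ≡-Reasoning

    ℘ : Carrier → Carrier
    ℘ x = x *ᶠ x +ᶠ x

    ℘-+ : ∀ x y → ℘ (x +ᶠ y) ≡ ℘ x +ᶠ ℘ y
    ℘-+ x y = trans (cong (_+ᶠ (x +ᶠ y)) (square-+ x y)) (+-interchange (x *ᶠ x) (y *ᶠ y) x y)

    ℘0≡0 : ℘ 0ᶠ ≡ 0ᶠ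
    ℘0≡0 = trans (+-identityʳ (0ᶠ *ᶠ 0ᶠ)) (zeroˡ 0ᶠ)

    ℘1≡0 : ℘ 1ᶠ ≡ 0ᶠ
    ℘1≡0 = trans (cong (_+ᶠ 1ᶠ) (*-identityˡ 1ᶠ)) 1+1≡0

module FiniteField (F : Field) {m : ℕ} (F↔Fin : Field.Carrier F ↔ Fin m) where
  open FieldProperties F
  open FiniteType F↔Fin
  open Inverse F↔Fin using (to; from; strictlyInverseʳ)
  open MonoidSum (CommutativeRing.+-commutativeMonoid ring)
    using (sum; sum-permute; ∑-distrib-+; sum-replicate; sum-cong-≗)
  open SemiringMult (CommutativeRing.semiring ring) using (×1-homo-*) renaming (_×_ to _·_)
  open RingProperties (CommutativeRing.ring ring) using (//-rightDividesˡ; //-rightDividesʳ)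

  translation : Carrier ↔ Carrier
  translation = mk↔ₛ′ (_+ᶠ 1ᶠ) (_+ᶠ -ᶠ 1ᶠ) (//-rightDividesˡ 1ᶠ) (//-rightDividesʳ 1ᶠ)

  -- Σ x = Σ (x + 1) = Σ x + m · 1, summing over all x ∈ F.
  card·1≡0 : m · 1ᶠ ≡ 0ᶠ
  card·1≡0 = +-identityʳ-unique (sum from) (m · 1ᶠ) (sym (begin
    sum from                              ≡⟨ sum-permute from (F↔Fin ↔-∘ (translation ↔-∘ ↔-sym F↔Fin)) ⟩
    sum (λ i → from (to (from i +ᶠ 1ᶠ)))  ≡⟨ sum-cong-≗ (λ i → strictlyInverseʳ (from i +ᶠ 1ᶠ)) ⟩
    sum (λ i → from i +ᶠ 1ᶠ)              ≡⟨ ∑-distrib-+ from (λ _ → 1ᶠ) ⟩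
    sum from +ᶠ sum {m} (λ _ → 1ᶠ)        ≡⟨ cong (sum from +ᶠ_) (sum-replicate m) ⟩
    sum from +ᶠ m · 1ᶠ                    ∎))
    where open ≡-Reasoning

  2^n·1≡0⇒1+1≡0 : ∀ n → (2 ^ n) · 1ᶠ ≡ 0ᶠ → 1ᶠ +ᶠ 1ᶠ ≡ 0ᶠ
  2^n·1≡0⇒1+1≡0 zero 1+0≡0 = ⊥-elim (0≢1 (sym (trans (sym (+-identityʳ 1ᶠ)) 1+0≡0)))
  2^n·1≡0⇒1+1≡0 (suc n) 2^[1+n]·1≡0 with (1ᶠ +ᶠ 1ᶠ) ≟ 0ᶠ
  ... | yes 1+1≡0 = 1+1≡0
  ... | no 1+1≢0 = 2^n·1≡0⇒1+1≡0 n (x*y≡0⇒y≡0 1+1≢0 (begin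
    (1ᶠ +ᶠ 1ᶠ) *ᶠ (2 ^ n) · 1ᶠ  ≡⟨ cong (λ z → (1ᶠ +ᶠ z) *ᶠ (2 ^ n) · 1ᶠ) (sym (+-identityʳ 1ᶠ)) ⟩
    (2 · 1ᶠ) *ᶠ (2 ^ n) · 1ᶠ    ≡⟨ sym (×1-homo-* 2 (2 ^ n)) ⟩
    (2 ^ suc n) · 1ᶠ            ≡⟨ 2^[1+n]·1≡0 ⟩
    0ᶠ                          ∎))
    where open ≡-Reasoning

  characteristic-2 : ∀ n → m ≡ 2 ^ n → 1ᶠ +ᶠ 1ᶠ ≡ 0ᶠ
  characteristic-2 n refl = 2^n·1≡0⇒1+1≡0 n card·1≡0

module FiniteFieldOfCharacteristic2 (F : Field) {m : ℕ} (F↔Fin : Field.Carrier F ↔ Fin m)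
                                    (1+1≡0 : Field._+ᶠ_ F (Field.1ᶠ F) (Field.1ᶠ F) ≡ Field.0ᶠ F) where
  open FieldProperties F
  open Characteristic2 1+1≡0
  open FiniteType F↔Fin
  open Inverse F↔Fin using (to)

  square≡0⇒≡0 : ∀ {x} → x *ᶠ x ≡ 0ᶠ → x ≡ 0ᶠ
  square≡0⇒≡0 {x} x²≡0 with x ≟ 0ᶠ
  ... | yes x≡0 = x≡0
  ... | no x≢0 = x*y≡0⇒y≡0 x≢0 x²≡0

  square-injective : Injective _≡_ _≡_ (λ x → x *ᶠ x)
  square-injective {x} {y} x²≡y² = x+y≡0⇒x≡y (square≡0⇒≡0 (trans (square-+ x y) (x≡y⇒x+y≡0 x²≡y²)))

  √ : ∀ y → ∃ λ x → x *ᶠ x ≡ y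
  √ = injective⇒surjective (λ x → x *ᶠ x) square-injective

  ℘-kernel : ∀ {x} → ℘ x ≡ 0ᶠ → x ≡ 0ᶠ ⊎ x ≡ 1ᶠ
  ℘-kernel {x} ℘x≡0 with x ≟ 0ᶠ
  ... | yes x≡0 = inj₁ x≡0
  ... | no x≢0 = inj₂ (x+y≡0⇒x≡y (x*y≡0⇒y≡0 x≢0 (begin
    x *ᶠ (x +ᶠ 1ᶠ)     ≡⟨ distribˡ x x 1ᶠ ⟩
    x *ᶠ x +ᶠ x *ᶠ 1ᶠ  ≡⟨ cong (x *ᶠ x +ᶠ_) (*-identityʳ x) ⟩
    ℘ x                ≡⟨ ℘x≡0 ⟩
    0ᶠ                 ∎)))
    where open ≡-Reasoning

  ℘-fibre : ∀ {x y} → ℘ x ≡ ℘ y → y ≡ x ⊎ y ≡ x +ᶠ 1ᶠ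
  ℘-fibre {x} {y} ℘x≡℘y with ℘-kernel (trans (℘-+ x y) (x≡y⇒x+y≡0 ℘x≡℘y))
  ... | inj₁ x+y≡0 = inj₁ (sym (x+y≡0⇒x≡y x+y≡0))
  ... | inj₂ x+y≡1 = inj₂ (trans (sym (x+[x+y]≡y x y)) (cong (x +ᶠ_) x+y≡1))

  ℘-missed : ∃ λ c → ∀ x → ℘ x ≢ c
  ℘-missed = ¬injective⇒missesValue ℘ (λ ℘-inj → 0≢1 (℘-inj (trans ℘0≡0 (sym ℘1≡0))))

  c : Carrier
  c = proj₁ ℘-missed

  ℘≢c : ∀ x → ℘ x ≢ c
  ℘≢c = proj₂ ℘-missed

  c≢0 : c ≢ 0ᶠ
  c≢0 c≡0 = ℘≢c 0ᶠ (trans ℘0≡0 (sym c≡0))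

  ℘≢℘+c : ∀ x y → ℘ x ≢ ℘ y +ᶠ c
  ℘≢℘+c x y ℘x≡℘y+c = ℘≢c (x +ᶠ y) (begin
    ℘ (x +ᶠ y)         ≡⟨ ℘-+ x y ⟩
    ℘ x +ᶠ ℘ y         ≡⟨ cong (_+ᶠ ℘ y) ℘x≡℘y+c ⟩
    (℘ y +ᶠ c) +ᶠ ℘ y  ≡⟨ +-comm (℘ y +ᶠ c) (℘ y) ⟩
    ℘ y +ᶠ (℘ y +ᶠ c)  ≡⟨ x+[x+y]≡y (℘ y) c ⟩
    c                  ∎)
    where open ≡-Reasoning

  x+1≢x : ∀ x → x +ᶠ 1ᶠ ≢ x
  x+1≢x x x+1≡x = 0≢1 (sym (+-cancelˡ x 1ᶠ 0ᶠ (trans x+1≡x (sym (+-identityʳ x)))))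

  x+1+1≡x : ∀ x → x +ᶠ 1ᶠ +ᶠ 1ᶠ ≡ x
  x+1+1≡x x = trans (+-assoc x 1ᶠ 1ᶠ) (trans (cong (x +ᶠ_) 1+1≡0) (+-identityʳ x))

  Lower : Carrier → Set
  Lower x = to x Fin.< to (x +ᶠ 1ᶠ)

  Lower? : ∀ x → Dec (Lower x)
  Lower? x = to x Fin.<? to (x +ᶠ 1ᶠ)

  Lower-exclusive : ∀ {x} → Lower x → ¬ Lower (x +ᶠ 1ᶠ)
  Lower-exclusive {x} x↓ x+1↓ = FinP.<-asym x↓ (subst (λ z → to (x +ᶠ 1ᶠ) Fin.< to z) (x+1+1≡x x) x+1↓)

  Lower-exhaustive : ∀ {x} → ¬ Lower x → Lower (x +ᶠ 1ᶠ)
  Lower-exhaustive {x} x↑ = subst (λ z → to (x +ᶠ 1ᶠ) Fin.< to z) (sym (x+1+1≡x x))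
    (FinP.≤∧≢⇒< (ℕP.≮⇒≥ x↑) (λ eq → x+1≢x x (to-injective eq)))

  -- ℘ identifies exactly the pairs {x, x + 1}; shifting the value at the upper element of each
  -- pair by c ∉ ℘ F gives an injection, hence a bijection, so every y is ℘ x or ℘ x + c.
  ψ : Carrier → Carrier
  ψ x with Lower? x
  ... | yes _ = ℘ x
  ... | no _ = ℘ x +ᶠ c

  ψ-injective : Injective _≡_ _≡_ ψ
  ψ-injective {x} {y} ψx≡ψy with Lower? x | Lower? y
  ... | yes _  | no _   = ⊥-elim (℘≢℘+c x y ψx≡ψy)
  ... | no _   | yes _  = ⊥-elim (℘≢℘+c y x (sym ψx≡ψy))
  ... | yes x↓ | yes y↓ with ℘-fibre ψx≡ψy
  ...   | inj₁ y≡x = sym y≡x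
  ...   | inj₂ refl = ⊥-elim (Lower-exclusive x↓ y↓)
  ψ-injective {x} {y} ψx≡ψy | no x↑ | no y↑ with ℘-fibre (+-cancelʳ c (℘ x) (℘ y) ψx≡ψy)
  ...   | inj₁ y≡x = sym y≡x
  ...   | inj₂ refl = ⊥-elim (y↑ (Lower-exhaustive x↑))

  ℘-split : ∀ y → (∃ λ x → ℘ x ≡ y) ⊎ (∃ λ x → ℘ x +ᶠ c ≡ y)
  ℘-split y with injective⇒surjective ψ ψ-injective y
  ... | x , ψx≡y with Lower? x
  ...   | yes _ = inj₁ (x , ψx≡y)
  ...   | no _ = inj₂ (x , ψx≡y)

module Polynomials (F : Field) where
  open FieldProperties F
  open Poly F

  infixl 6 _⊕_
  _⊕_ : Coeffs → Coeffs → Coeffs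
  (r ⊕ s) k = r k +ᶠ s k

  DegreeBelow : ℕ → Coeffs → Set
  DegreeBelow n r = ∀ k → n ≤ k → r k ≡ 0ᶠ

  DegreeBelow-mono : ∀ {m n r} → m ≤ n → DegreeBelow m r → DegreeBelow n r
  DegreeBelow-mono m≤n deg k n≤k = deg k (ℕP.≤-trans m≤n n≤k)

  DegreeBelow-⊕ : ∀ {n r s} → DegreeBelow n r → DegreeBelow n s → DegreeBelow n (r ⊕ s)
  DegreeBelow-⊕ deg-r deg-s k n≤k = trans (cong₂ _+ᶠ_ (deg-r k n≤k) (deg-s k n≤k)) (+-identityˡ 0ᶠ)

  fromVec-degree : ∀ {n} (rc : Fin n → Carrier) → DegreeBelow n (fromVec rc)
  fromVec-degree {n} rc k n≤k with k ℕ.<? n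
  ... | yes k<n = contradiction n≤k (ℕP.<⇒≱ k<n)
  ... | no _ = refl

  fromVec-restrict : ∀ {n r} → DegreeBelow n r → ∀ k → fromVec {n} (r ∘ Fin.toℕ) k ≡ r k
  fromVec-restrict {n} {r} deg k with k ℕ.<? n
  ... | yes k<n = cong r (FinP.toℕ-fromℕ< k<n)
  ... | no k≮n = sym (deg k (ℕP.≮⇒≥ k≮n))

  monomial : ℕ → Carrier → Coeffs
  monomial j a k with k ℕ.≟ j
  ... | yes _ = a
  ... | no _ = 0ᶠ

  monomial-coeff : ∀ j a → monomial j a j ≡ a
  monomial-coeff j a with j ℕ.≟ j
  ... | yes _ = refl
  ... | no j≢j = contradiction refl j≢j

  monomial-degree : ∀ j a → DegreeBelow (suc j) (monomial j a)
  monomial-degree j a k j<k with k ℕ.≟ j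
  ... | yes refl = contradiction j<k (ℕP.<-irrefl refl)
  ... | no _ = refl

  DegreeBelow-lower : ∀ {i r} → DegreeBelow (suc i) r → r i ≡ 0ᶠ → DegreeBelow i r
  DegreeBelow-lower {i} deg rᵢ≡0 k i≤k with i ℕ.≟ k
  ... | yes refl = rᵢ≡0
  ... | no i≢k = deg k (ℕP.≤∧≢⇒< i≤k i≢k)

  DegreeBelow-descend : ∀ {j n r} → j ℕ.≤‴ n → DegreeBelow n r →
                        (∀ {i} → j ≤ i → i < n → DegreeBelow (suc i) r → r i ≡ 0ᶠ) → DegreeBelow j r
  DegreeBelow-descend ℕ.≤‴-refl deg _ = deg
  DegreeBelow-descend (ℕ.≤‴-step j<‴n) deg top≡0 =
    DegreeBelow-lower deg′ (top≡0 ℕP.≤-refl (ℕP.≤‴⇒≤ j<‴n) deg′)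
    where
    deg′ = DegreeBelow-descend j<‴n deg (top≡0 ∘ ℕP.<⇒≤)

  sumTo-cong : ∀ n {f g} → (∀ i → i < n → f i ≡ g i) → sumTo n f ≡ sumTo n g
  sumTo-cong zero f≡g = refl
  sumTo-cong (suc n) f≡g = cong₂ _+ᶠ_ (sumTo-cong n (λ i i<n → f≡g i (ℕP.m<n⇒m<1+n i<n))) (f≡g n (ℕP.n<1+n n))

  sumTo-zero : ∀ n {f} → (∀ i → i < n → f i ≡ 0ᶠ) → sumTo n f ≡ 0ᶠ
  sumTo-zero zero f≡0 = refl
  sumTo-zero (suc n) f≡0 =
    trans (cong₂ _+ᶠ_ (sumTo-zero n (λ i i<n → f≡0 i (ℕP.m<n⇒m<1+n i<n))) (f≡0 n (ℕP.n<1+n n))) (+-identityˡ 0ᶠ)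

  sumTo-single : ∀ n {f} i → i < n → (∀ j → j < n → j ≢ i → f j ≡ 0ᶠ) → sumTo n f ≡ f i
  sumTo-single (suc n) {f} i i<1+n f≡0 with i ℕ.≟ n
  ... | yes refl = trans (cong (_+ᶠ f i) (sumTo-zero n (λ j j<n → f≡0 j (ℕP.m<n⇒m<1+n j<n) (ℕP.<⇒≢ j<n))))
                         (+-identityˡ (f i))
  ... | no i≢n = trans (cong₂ _+ᶠ_ (sumTo-single n i (ℕP.≤∧≢⇒< (ℕP.≤-pred i<1+n) i≢n)
                                                  (λ j j<n → f≡0 j (ℕP.m<n⇒m<1+n j<n)))
                                   (f≡0 n (ℕP.n<1+n n) (i≢n ∘ sym)))
                       (+-identityʳ (f i))

  sumTo-+ : ∀ n f g → sumTo n (λ i → f i +ᶠ g i) ≡ sumTo n f +ᶠ sumTo n g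
  sumTo-+ zero f g = sym (+-identityˡ 0ᶠ)
  sumTo-+ (suc n) f g = trans (cong (_+ᶠ (f n +ᶠ g n)) (sumTo-+ n f g)) (+-interchange _ _ _ _)

  sumTo-suc : ∀ n f → sumTo (suc n) f ≡ f 0 +ᶠ sumTo n (f ∘ suc)
  sumTo-suc zero f = trans (+-identityˡ (f 0)) (sym (+-identityʳ (f 0)))
  sumTo-suc (suc n) f = trans (cong (_+ᶠ f (suc n)) (sumTo-suc n f)) (+-assoc _ _ _)

  mulCoeff-congˡ : ∀ {r s} t → (∀ i → r i ≡ s i) → ∀ k → mulCoeff r t k ≡ mulCoeff s t k
  mulCoeff-congˡ t r≗s k = sumTo-cong (suc k) (λ i _ → cong (_*ᶠ t (k ∸ i)) (r≗s i))

  mulCoeff-⊕ˡ : ∀ r s t k → mulCoeff (r ⊕ s) t k ≡ mulCoeff r t k +ᶠ mulCoeff s t k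
  mulCoeff-⊕ˡ r s t k =
    trans (sumTo-cong (suc k) (λ i _ → distribʳ (t (k ∸ i)) (r i) (s i))) (sumTo-+ (suc k) _ _)

  module _ {i j r s} (deg-r : DegreeBelow (suc i) r) (deg-s : DegreeBelow (suc j) s) where
    mulCoeff-term≡0 : ∀ {t k} → i < t ⊎ t + j < k → r t *ᶠ s (k ∸ t) ≡ 0ᶠ
    mulCoeff-term≡0 {t} (inj₁ i<t) = trans (cong (_*ᶠ _) (deg-r t i<t)) (zeroˡ _)
    mulCoeff-term≡0 {t} {k} (inj₂ t+j<k) =
      trans (cong (r t *ᶠ_) (deg-s (k ∸ t) (ℕP.m+n≤o⇒m≤o∸n (suc j) (subst (_< k) (ℕP.+-comm t j) t+j<k))))
            (zeroʳ _)

    mulCoeff-vanishes : ∀ {k} → i + j < k → mulCoeff r s k ≡ 0ᶠ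
    mulCoeff-vanishes {k} i+j<k = sumTo-zero (suc k) (λ t _ → mulCoeff-term≡0 (beyond t))
      where
      beyond : ∀ t → i < t ⊎ t + j < k
      beyond t with i ℕ.<? t
      ... | yes i<t = inj₁ i<t
      ... | no i≮t = inj₂ (ℕP.≤-<-trans (ℕP.+-monoˡ-≤ j (ℕP.≮⇒≥ i≮t)) i+j<k)

    mulCoeff-leading : mulCoeff r s (i + j) ≡ r i *ᶠ s j
    mulCoeff-leading =
      trans (sumTo-single (suc (i + j)) i (s≤s (ℕP.m≤m+n i j)) (λ t _ t≢i → mulCoeff-term≡0 (off t t≢i)))
            (cong (λ n → r i *ᶠ s n) (ℕP.m+n∸m≡n i j))
      where
      off : ∀ t → t ≢ i → i < t ⊎ t + j < i + j
      off t t≢i with ℕP.<-cmp t i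
      ... | tri< t<i _ _ = inj₂ (ℕP.+-monoˡ-< j t<i)
      ... | tri≈ _ t≡i _ = contradiction t≡i t≢i
      ... | tri> _ _ i<t = inj₁ i<t

  frobenius : Coeffs → Coeffs
  frobenius r zero = r 0 *ᶠ r 0
  frobenius r (suc zero) = 0ᶠ
  frobenius r (suc (suc k)) = frobenius (r ∘ suc) k

  frobenius-cong : ∀ {r s} → (∀ i → r i ≡ s i) → ∀ k → frobenius r k ≡ frobenius s k
  frobenius-cong r≗s zero = cong₂ _*ᶠ_ (r≗s 0) (r≗s 0)
  frobenius-cong r≗s (suc zero) = refl
  frobenius-cong r≗s (suc (suc k)) = frobenius-cong (r≗s ∘ suc) k

  frobenius-zero : ∀ k → frobenius (λ _ → 0ᶠ) k ≡ 0ᶠ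
  frobenius-zero zero = zeroˡ 0ᶠ
  frobenius-zero (suc zero) = refl
  frobenius-zero (suc (suc k)) = frobenius-zero k

  frobenius-even : ∀ r h → frobenius r (h + h) ≡ r h *ᶠ r h
  frobenius-even r zero = refl
  frobenius-even r (suc h) rewrite ℕP.+-suc h h = frobenius-even (r ∘ suc) h

  frobenius-odd : ∀ r h → frobenius r (suc (h + h)) ≡ 0ᶠ
  frobenius-odd r zero = refl
  frobenius-odd r (suc h) rewrite ℕP.+-suc h h = frobenius-odd (r ∘ suc) h

  frobenius-vanishes : ∀ {i r} → DegreeBelow (suc i) r → ∀ {k} → i + i < k → frobenius r k ≡ 0ᶠ
  frobenius-vanishes {i} {r} deg {k} i+i<k with parity k
  ... | even h = trans (frobenius-even r h) (trans (cong (λ z → z *ᶠ z) (deg h (m+m<n+n⇒m<n i+i<k))) (zeroˡ 0ᶠ))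
  ... | odd h = frobenius-odd r h

  module _ (1+1≡0 : 1ᶠ +ᶠ 1ᶠ ≡ 0ᶠ) where
    open Characteristic2 1+1≡0

    frobenius-⊕ : ∀ r s k → frobenius (r ⊕ s) k ≡ frobenius r k +ᶠ frobenius s k
    frobenius-⊕ r s zero = square-+ (r 0) (s 0)
    frobenius-⊕ r s (suc zero) = sym (+-identityˡ 0ᶠ)
    frobenius-⊕ r s (suc (suc k)) = frobenius-⊕ (r ∘ suc) (s ∘ suc) k

    mulCoeff-self : ∀ r k → mulCoeff r r k ≡ frobenius r k
    mulCoeff-self r zero = +-identityˡ _
    mulCoeff-self r (suc zero) =
      trans (cong (_+ᶠ r 1 *ᶠ r 0) (+-identityˡ (r 0 *ᶠ r 1))) (x≡y⇒x+y≡0 (*-comm (r 0) (r 1)))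
    mulCoeff-self r (suc (suc k)) = begin
      sumTo (suc (suc k)) f +ᶠ f (2 + k)           ≡⟨ cong (_+ᶠ f (2 + k)) (sumTo-suc (suc k) f) ⟩
      f 0 +ᶠ sumTo (suc k) (f ∘ suc) +ᶠ f (2 + k)  ≡⟨ cong (λ z → f 0 +ᶠ z +ᶠ f (2 + k)) inner ⟩
      f 0 +ᶠ frobenius (r ∘ suc) k +ᶠ f (2 + k)    ≡⟨ cong (f 0 +ᶠ frobenius (r ∘ suc) k +ᶠ_) outer ⟩
      f 0 +ᶠ frobenius (r ∘ suc) k +ᶠ f 0          ≡⟨ +-comm _ (f 0) ⟩
      f 0 +ᶠ (f 0 +ᶠ frobenius (r ∘ suc) k)        ≡⟨ x+[x+y]≡y (f 0) _ ⟩
      frobenius (r ∘ suc) k                        ∎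
      where
      open ≡-Reasoning
      f : ℕ → Carrier
      f i = r i *ᶠ r (2 + k ∸ i)
      inner : sumTo (suc k) (f ∘ suc) ≡ frobenius (r ∘ suc) k
      inner = trans (sumTo-cong (suc k) (λ i i≤k → cong (λ n → r (suc i) *ᶠ r n) (ℕP.+-∸-assoc 1 (ℕP.≤-pred i≤k))))
                    (mulCoeff-self (r ∘ suc) k)
      outer : f (2 + k) ≡ f 0
      outer = trans (cong (λ n → r (2 + k) *ᶠ r n) (ℕP.n∸n≡0 (2 + k))) (*-comm _ _)

-- With G = g + 1, the 2G + 1 coefficient positions of V split into the pivots, where r v + r²
-- with deg r = i ≤ G has its leading coefficient, and G free positions.
module Positions (d : ℕ) where
  pivot : ℕ → ℕ
  pivot i = (i + d) ⊔ (i + i)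

  pivot-< : ∀ {i} → i < d → pivot i ≡ i + d
  pivot-< {i} i<d = ℕP.m≥n⇒m⊔n≡m (ℕP.+-monoʳ-≤ i (ℕP.<⇒≤ i<d))

  pivot-≥ : ∀ {i} → d ≤ i → pivot i ≡ i + i
  pivot-≥ {i} d≤i = ℕP.m≤n⇒m⊔n≡n (ℕP.+-monoʳ-≤ i d≤i)

  pivot-mono-< : ∀ {i j} → i < j → pivot i < pivot j
  pivot-mono-< i<j = ℕP.⊔-mono-< (ℕP.+-monoˡ-< d i<j) (ℕP.+-mono-< i<j i<j)

  pivot-injective : Injective _≡_ _≡_ pivot
  pivot-injective = <-mono⇒injective pivot-mono-<

  free : ℕ → ℕ
  free j with j ℕ.<? d
  ... | yes _ = j
  ... | no _ = suc (j + j)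

  free-< : ∀ {j} → j < d → free j ≡ j
  free-< {j} j<d with j ℕ.<? d
  ... | yes _ = refl
  ... | no j≮d = contradiction j<d j≮d

  free-≥ : ∀ {j} → d ≤ j → free j ≡ suc (j + j)
  free-≥ {j} d≤j with j ℕ.<? d
  ... | yes j<d = contradiction d≤j (ℕP.<⇒≱ j<d)
  ... | no _ = refl

  free-mono-< : ∀ {i j} → i < j → free i < free j
  free-mono-< {i} {j} i<j with i ℕ.<? d | j ℕ.<? d
  ... | yes _   | yes _   = i<j
  ... | yes _   | no _    = ℕP.<-≤-trans i<j (ℕP.m≤n⇒m≤1+n (ℕP.m≤m+n j j))
  ... | no i≮d  | yes j<d = contradiction (ℕP.<-trans i<j j<d) i≮d
  ... | no _    | no _    = s≤s (ℕP.+-mono-< i<j i<j)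

  free-injective : Injective _≡_ _≡_ free
  free-injective = <-mono⇒injective free-mono-<

  pivot≢free : ∀ i j → pivot i ≢ free j
  pivot≢free i j with j ℕ.<? d
  ... | yes j<d = ℕP.>⇒≢ (ℕP.<-≤-trans j<d (ℕP.≤-trans (ℕP.m≤n+m d i) (ℕP.m≤m⊔n _ _)))
  ... | no j≮d with ℕP.≮⇒≥ j≮d | i ℕ.<? d
  ...   | d≤j | yes i<d = ℕP.<⇒≢ (ℕP.<-≤-trans (subst (_< d + d) (sym (pivot-< i<d)) (ℕP.+-monoˡ-< d i<d))
                                            (ℕP.≤-trans (ℕP.+-mono-≤ d≤j d≤j) (ℕP.n≤1+n _)))
  ...   | _   | no i≮d  = m+m≢1+n+n {i} {j} ∘ trans (sym (pivot-≥ (ℕP.≮⇒≥ i≮d)))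

  module _ {G} (d≤G : d ≤ G) where
    pivot-bound : ∀ {i} → i ≤ G → pivot i < suc (G + G)
    pivot-bound {i} i≤G = s≤s (ℕP.⊔-lub (ℕP.+-mono-≤ i≤G d≤G) (ℕP.+-mono-≤ i≤G i≤G))

    free-bound : ∀ {j} → j < G → free j < suc (G + G)
    free-bound {j} j<G with j ℕ.<? d
    ... | yes _ = ℕP.≤-trans j<G (ℕP.≤-trans (ℕP.m≤m+n G G) (ℕP.n≤1+n _))
    ... | no _ = s≤s (ℕP.+-mono-< j<G j<G)

    Slot : ℕ → Set
    Slot k = (∃ λ i → i ≤ G × pivot i ≡ k) ⊎ (∃ λ j → j < G × free j ≡ k)

    classify : ∀ {k} → k < suc (G + G) → Slot k
    classify {k} k<N with k ℕ.<? d
    ... | yes k<d = inj₂ (k , ℕP.<-≤-trans k<d d≤G , free-< k<d)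
    ... | no k≮d with k ℕ.<? d + d
    ...   | yes k<d+d =
      inj₁ (k ∸ d , ℕP.≤-trans (ℕP.<⇒≤ k∸d<d) d≤G , trans (pivot-< k∸d<d) (ℕP.m∸n+n≡m (ℕP.≮⇒≥ k≮d)))
      where
      k∸d<d : k ∸ d < d
      k∸d<d = subst (k ∸ d <_) (ℕP.m+n∸n≡m d d) (ℕP.∸-monoˡ-< k<d+d (ℕP.≮⇒≥ k≮d))
    ...   | no k≮d+d with parity k
    ...     | even h = inj₁ (h , m+m≤n+n⇒m≤n (ℕP.≤-pred k<N) , pivot-≥ {h} (m+m≤n+n⇒m≤n (ℕP.≮⇒≥ k≮d+d)))
    ...     | odd h = inj₂ (h , m+m<n+n⇒m<n (ℕP.≤-pred k<N) , free-≥ (m+m≤1+n+n⇒m≤n (ℕP.≮⇒≥ k≮d+d)))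

module ΦMap (F : Field) (1+1≡0 : Field._+ᶠ_ F (Field.1ᶠ F) (Field.1ᶠ F) ≡ Field.0ᶠ F)
            (d : ℕ) (vc : Fin d → Field.Carrier F) where
  open FieldProperties F
  open Characteristic2 1+1≡0
  open Poly F
  open Polynomials F
  open Positions d

  v : Coeffs
  v = monic d vc

  v-degree : DegreeBelow (suc d) v
  v-degree k d<k with k ℕ.<? d | k ℕ.≟ d
  ... | yes k<d | _      = contradiction k<d (ℕP.<-asym d<k)
  ... | no _    | yes refl = contradiction d<k (ℕP.<-irrefl refl)
  ... | no _    | no _   = refl

  v-leading : v d ≡ 1ᶠ
  v-leading with d ℕ.<? d | d ℕ.≟ d
  ... | yes d<d | _      = contradiction d<d (ℕP.<-irrefl refl)
  ... | no _    | yes _  = refl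
  ... | no _    | no d≢d = contradiction refl d≢d

  -- r v + r², with r² written as frobenius r (see mulCoeff-self)
  φ : Coeffs → Coeffs
  φ r k = mulCoeff r v k +ᶠ frobenius r k

  φ-cong : ∀ {r s} → (∀ i → r i ≡ s i) → ∀ k → φ r k ≡ φ s k
  φ-cong r≗s k = cong₂ _+ᶠ_ (mulCoeff-congˡ v r≗s k) (frobenius-cong r≗s k)

  φ-⊕ : ∀ r s k → φ (r ⊕ s) k ≡ φ r k +ᶠ φ s k
  φ-⊕ r s k = trans (cong₂ _+ᶠ_ (mulCoeff-⊕ˡ r s v k) (frobenius-⊕ 1+1≡0 r s k)) (+-interchange _ _ _ _)

  φ-zero : ∀ k → φ (λ _ → 0ᶠ) k ≡ 0ᶠ
  φ-zero k = trans (cong₂ _+ᶠ_ (sumTo-zero (suc k) (λ i _ → zeroˡ _)) (frobenius-zero k)) (+-identityˡ 0ᶠ)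

  φ-v : ∀ k → φ v k ≡ 0ᶠ
  φ-v k = x≡y⇒x+y≡0 (mulCoeff-self 1+1≡0 v k)

  mulCoeff-v-leading : ∀ {i r} → DegreeBelow (suc i) r → mulCoeff r v (i + d) ≡ r i
  mulCoeff-v-leading {i} {r} deg = trans (mulCoeff-leading deg v-degree) (trans (cong (r i *ᶠ_) v-leading) (*-identityʳ (r i)))

  module _ {i r} (deg : DegreeBelow (suc i) r) where
    φ-vanishes : ∀ {k} → pivot i < k → φ r k ≡ 0ᶠ
    φ-vanishes pivot<k =
      trans (cong₂ _+ᶠ_ (mulCoeff-vanishes deg v-degree (ℕP.≤-<-trans (ℕP.m≤m⊔n _ _) pivot<k))
                        (frobenius-vanishes deg (ℕP.≤-<-trans (ℕP.m≤n⊔m _ _) pivot<k)))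
            (+-identityˡ 0ᶠ)

    φ-pivot-< : i < d → φ r (pivot i) ≡ r i
    φ-pivot-< i<d =
      trans (cong (φ r) (pivot-< i<d))
            (trans (cong₂ _+ᶠ_ (mulCoeff-v-leading deg) (frobenius-vanishes deg (ℕP.+-monoʳ-< i i<d))) (+-identityʳ (r i)))

    φ-pivot-> : d < i → φ r (pivot i) ≡ r i *ᶠ r i
    φ-pivot-> d<i =
      trans (cong (φ r) (pivot-≥ (ℕP.<⇒≤ d<i)))
            (trans (cong₂ _+ᶠ_ (mulCoeff-vanishes deg v-degree (ℕP.+-monoʳ-< i d<i)) (frobenius-even r i)) (+-identityˡ _))

  φ-pivot-d : ∀ {r} → DegreeBelow (suc d) r → φ r (pivot d) ≡ ℘ (r d)
  φ-pivot-d {r} deg =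
    trans (cong (φ r) (pivot-≥ ℕP.≤-refl))
          (trans (cong₂ _+ᶠ_ (mulCoeff-v-leading deg) (frobenius-even r d)) (+-comm (r d) _))

module NormalForms (F : Field) {m : ℕ} (F↔Fin : Field.Carrier F ↔ Fin m)
                   (1+1≡0 : Field._+ᶠ_ F (Field.1ᶠ F) (Field.1ᶠ F) ≡ Field.0ᶠ F)
                   (d : ℕ) (vc : Fin d → Field.Carrier F) {G : ℕ} (d≤G : d ≤ G) where
  open FieldProperties F
  open Characteristic2 1+1≡0
  open FiniteFieldOfCharacteristic2 F F↔Fin 1+1≡0
  open Poly F
  open Polynomials F
  open Positions d
  open ΦMap F 1+1≡0 d vc

  IsNormalAt : ℕ → Carrier → Set
  IsNormalAt i x = x ≡ 0ᶠ ⊎ (i ≡ d × x ≡ c)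

  Normal : Coeffs → Set
  Normal u = ∀ i → i ≤ G → IsNormalAt i (u (pivot i))

  IsNormalAt-≢ : ∀ {i x} → i ≢ d → IsNormalAt i x → x ≡ 0ᶠ
  IsNormalAt-≢ i≢d (inj₁ x≡0) = x≡0
  IsNormalAt-≢ i≢d (inj₂ (i≡d , _)) = contradiction i≡d i≢d

  IsNormalAt-+ : ∀ {i x y} → IsNormalAt i x → IsNormalAt i y → IsNormalAt i (x +ᶠ y)
  IsNormalAt-+ (inj₁ refl) (inj₁ refl) = inj₁ (+-identityˡ 0ᶠ)
  IsNormalAt-+ (inj₁ refl) (inj₂ (i≡d , refl)) = inj₂ (i≡d , +-identityˡ c)
  IsNormalAt-+ (inj₂ (i≡d , refl)) (inj₁ refl) = inj₂ (i≡d , +-identityʳ c)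
  IsNormalAt-+ (inj₂ (_ , refl)) (inj₂ (_ , refl)) = inj₁ (x+x≡0 c)

  Normal-⊕ : ∀ {u u′} → Normal u → Normal u′ → Normal (u ⊕ u′)
  Normal-⊕ normal normal′ i i≤G = IsNormalAt-+ (normal i i≤G) (normal′ i i≤G)

  φ-monomial-pivot-d : ∀ a → φ (monomial d a) (pivot d) ≡ ℘ a
  φ-monomial-pivot-d a = trans (φ-pivot-d (monomial-degree d a)) (cong ℘ (monomial-coeff d a))

  normalising-coefficient : ∀ j y → ∃ λ a → IsNormalAt j (y +ᶠ φ (monomial j a) (pivot j))
  normalising-coefficient j y with ℕP.<-cmp j d
  ... | tri< j<d _ _ = y , inj₁ (begin
    y +ᶠ φ (monomial j y) (pivot j)  ≡⟨ cong (y +ᶠ_) (φ-pivot-< (monomial-degree j y) j<d) ⟩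
    y +ᶠ monomial j y j              ≡⟨ cong (y +ᶠ_) (monomial-coeff j y) ⟩
    y +ᶠ y                           ≡⟨ x+x≡0 y ⟩
    0ᶠ                               ∎)
    where open ≡-Reasoning
  ... | tri> _ _ d<j with a , a²≡y ← √ y = a , inj₁ (begin
    y +ᶠ φ (monomial j a) (pivot j)        ≡⟨ cong (y +ᶠ_) (φ-pivot-> (monomial-degree j a) d<j) ⟩
    y +ᶠ monomial j a j *ᶠ monomial j a j  ≡⟨ cong (λ z → y +ᶠ z *ᶠ z) (monomial-coeff j a) ⟩
    y +ᶠ a *ᶠ a                            ≡⟨ x≡y⇒x+y≡0 (sym a²≡y) ⟩
    0ᶠ                                     ∎)
    where open ≡-Reasoning
  ... | tri≈ _ refl _ with ℘-split y
  ...   | inj₁ (a , ℘a≡y) = a , inj₁ (trans (cong (y +ᶠ_) (φ-monomial-pivot-d a)) (x≡y⇒x+y≡0 (sym ℘a≡y)))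
  ...   | inj₂ (a , ℘a+c≡y) = a , inj₂ (refl , (begin
    y +ᶠ φ (monomial d a) (pivot d)  ≡⟨ cong (y +ᶠ_) (φ-monomial-pivot-d a) ⟩
    y +ᶠ ℘ a                         ≡⟨ cong (_+ᶠ ℘ a) (sym ℘a+c≡y) ⟩
    ℘ a +ᶠ c +ᶠ ℘ a                  ≡⟨ +-comm _ (℘ a) ⟩
    ℘ a +ᶠ (℘ a +ᶠ c)                ≡⟨ x+[x+y]≡y (℘ a) c ⟩
    c                                ∎))
    where open ≡-Reasoning


  ⊕-φ-⊕ : ∀ w r s k → (w ⊕ φ (r ⊕ s)) k ≡ (w ⊕ φ r) k +ᶠ φ s k
  ⊕-φ-⊕ w r s k = trans (cong (w k +ᶠ_) (φ-⊕ r s k)) (sym (+-assoc _ _ _))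

  -- Pivots are fixed from the top down: the monomial added at j does not move the
  -- coefficients at the higher pivots, which lie beyond pivot j.
  normaliseFrom : ∀ w {j} → j ℕ.≤‴ suc G →
                  ∃ λ r → DegreeBelow (suc G) r × (∀ i → j ≤ i → i ≤ G → IsNormalAt i ((w ⊕ φ r) (pivot i)))
  normaliseFrom w ℕ.≤‴-refl = (λ _ → 0ᶠ) , (λ _ _ → refl) , λ i G<i i≤G → contradiction i≤G (ℕP.<⇒≱ G<i)
  normaliseFrom w {j} (ℕ.≤‴-step j<‴1+G)
    with r , deg , normal ← normaliseFrom w j<‴1+G
    with a , normalᵃ ← normalising-coefficient j ((w ⊕ φ r) (pivot j))
    = r ⊕ monomial j a , DegreeBelow-⊕ deg (DegreeBelow-mono (ℕP.≤‴⇒≤ j<‴1+G) (monomial-degree j a)) , normal′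
    where
    normal′ : ∀ i → j ≤ i → i ≤ G → IsNormalAt i ((w ⊕ φ (r ⊕ monomial j a)) (pivot i))
    normal′ i j≤i i≤G with j ℕ.≟ i
    ... | yes refl = subst (IsNormalAt j) (sym (⊕-φ-⊕ w r (monomial j a) (pivot j))) normalᵃ
    ... | no j≢i = subst (IsNormalAt i) (sym unchanged) (normal i j<i i≤G)
      where
      j<i = ℕP.≤∧≢⇒< j≤i j≢i
      unchanged : (w ⊕ φ (r ⊕ monomial j a)) (pivot i) ≡ (w ⊕ φ r) (pivot i)
      unchanged = trans (⊕-φ-⊕ w r (monomial j a) (pivot i))
                        (trans (cong ((w ⊕ φ r) (pivot i) +ᶠ_) (φ-vanishes (monomial-degree j a) (pivot-mono-< j<i)))
                               (+-identityʳ _))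

  normalise : ∀ w → ∃ λ r → DegreeBelow (suc G) r × Normal (w ⊕ φ r)
  normalise w with r , deg , normal ← normaliseFrom w (ℕP.≤⇒≤‴ z≤n) = r , deg , λ i → normal i z≤n

  -- Reading the pivots from the top down forces r = 0 or r = v, the two solutions of r v + r² = 0.
  φ-normal⇒≡0 : ∀ {r} → DegreeBelow (suc G) r → Normal (φ r) → ∀ k → φ r k ≡ 0ᶠ
  φ-normal⇒≡0 {r} deg normal k = begin
    φ r k           ≡⟨ sym (φ-r′ k) ⟩
    φ r′ k          ≡⟨ φ-cong (λ t → r′≡0 t z≤n) k ⟩
    φ (λ _ → 0ᶠ) k  ≡⟨ φ-zero k ⟩
    0ᶠ              ∎
    where
    open ≡-Reasoning
    deg-d : DegreeBelow (suc d) r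
    deg-d = DegreeBelow-descend (ℕP.≤⇒≤‴ (s≤s d≤G)) deg λ {i} d<i i<1+G deg-i →
      square≡0⇒≡0 (trans (sym (φ-pivot-> deg-i d<i)) (IsNormalAt-≢ (ℕP.>⇒≢ d<i) (normal i (ℕP.≤-pred i<1+G))))

    ℘rd≡0 : ℘ (r d) ≡ 0ᶠ
    ℘rd≡0 with subst (IsNormalAt d) (φ-pivot-d deg-d) (normal d d≤G)
    ... | inj₁ ℘rd≡0 = ℘rd≡0
    ... | inj₂ (_ , ℘rd≡c) = contradiction ℘rd≡c (℘≢c (r d))

    rd·v : Coeffs
    rd·v t = r d *ᶠ v t

    φ-rd·v : ∀ k → φ rd·v k ≡ 0ᶠ
    φ-rd·v k with ℘-kernel ℘rd≡0
    ... | inj₁ rd≡0 = trans (φ-cong (λ t → trans (cong (_*ᶠ v t) rd≡0) (zeroˡ (v t))) k) (φ-zero k)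
    ... | inj₂ rd≡1 = trans (φ-cong (λ t → trans (cong (_*ᶠ v t) rd≡1) (*-identityˡ (v t))) k) (φ-v k)

    r′ : Coeffs
    r′ = r ⊕ rd·v

    φ-r′ : ∀ k → φ r′ k ≡ φ r k
    φ-r′ k = trans (φ-⊕ r rd·v k) (trans (cong (φ r k +ᶠ_) (φ-rd·v k)) (+-identityʳ (φ r k)))

    deg′ : DegreeBelow d r′
    deg′ t d≤t with d ℕ.≟ t
    ... | yes refl =
      trans (cong (λ z → r d +ᶠ r d *ᶠ z) v-leading) (trans (cong (r d +ᶠ_) (*-identityʳ (r d))) (x+x≡0 (r d)))
    ... | no d≢t =
      trans (cong₂ _+ᶠ_ (deg-d t d<t) (trans (cong (r d *ᶠ_) (v-degree t d<t)) (zeroʳ (r d)))) (+-identityˡ 0ᶠ)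
      where d<t = ℕP.≤∧≢⇒< d≤t d≢t

    r′≡0 : DegreeBelow 0 r′
    r′≡0 = DegreeBelow-descend (ℕP.≤⇒≤‴ z≤n) deg′ λ {i} _ i<d deg-i →
      trans (sym (φ-pivot-< deg-i i<d))
            (trans (φ-r′ (pivot i)) (IsNormalAt-≢ (ℕP.<⇒≢ i<d) (normal i (ℕP.≤-trans (ℕP.<⇒≤ i<d) d≤G))))

  normal-unique : ∀ {u u′ r} → Normal u → Normal u′ → DegreeBelow (suc G) r → (∀ k → (u ⊕ u′) k ≡ φ r k) →
                  ∀ k → u k ≡ u′ k
  normal-unique {u} {u′} normal normal′ deg u+u′≡φr k =
    x+y≡0⇒x≡y (trans (u+u′≡φr k) (φ-normal⇒≡0 deg normal-φr k))
    where
    normal-φr : Normal (φ _)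
    normal-φr i i≤G = subst (IsNormalAt i) (u+u′≡φr (pivot i)) (Normal-⊕ {u} {u′} normal normal′ i i≤G)

2g+3≡1+[1+g]+[1+g] : ∀ g → 2 * g + 3 ≡ suc (suc g + suc g)
2g+3≡1+[1+g]+[1+g] = solve-∀

module Quotient (g : ℕ) (F : Field) {m : ℕ} (F↔Fin : Field.Carrier F ↔ Fin m)
                (1+1≡0 : Field._+ᶠ_ F (Field.1ᶠ F) (Field.1ᶠ F) ≡ Field.0ᶠ F)
                (d : ℕ) (d≤G : d ≤ suc g) (vc : Fin d → Field.Carrier F) where
  open FieldProperties F
  open Characteristic2 1+1≡0
  open FiniteType F↔Fin using (_≟_)
  open FiniteFieldOfCharacteristic2 F F↔Fin 1+1≡0 using (c; c≢0)
  open Setup g F d vc using (N; uElem; SameCoset)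
  open Poly F
  open Polynomials F
  open Positions d
  open ΦMap F 1+1≡0 d vc
  open NormalForms F F↔Fin 1+1≡0 d vc d≤G
  open Encoding F↔Fin (suc g)
  open ≡-Reasoning

  N≡1+G+G : N ≡ suc (suc g + suc g)
  N≡1+G+G = 2g+3≡1+[1+g]+[1+g] g

  φ-beyond : ∀ {r} → DegreeBelow (suc (suc g)) r → DegreeBelow N (φ r)
  φ-beyond deg k N≤k = φ-vanishes deg (ℕP.<-≤-trans (pivot-bound d≤G ℕP.≤-refl) (subst (_≤ k) N≡1+G+G N≤k))

  ext : Quot N → Coeffs
  ext = fromVec

  ext-toℕ : ∀ w i → ext w (Fin.toℕ i) ≡ w i
  ext-toℕ w i with Fin.toℕ i ℕ.<? N
  ... | yes i<N = cong w (FinP.fromℕ<-toℕ i i<N)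
  ... | no i≮N = contradiction (FinP.toℕ<n i) i≮N

  uElem≡φ : ∀ rc i → uElem rc i ≡ φ (fromVec rc) (Fin.toℕ i)
  uElem≡φ rc i = cong (mulCoeff (fromVec rc) v (Fin.toℕ i) +ᶠ_) (mulCoeff-self 1+1≡0 (fromVec rc) (Fin.toℕ i))

  sameCoset⇒φ : ∀ {a b} → SameCoset a b → ∃ λ r → DegreeBelow (suc (suc g)) r × (∀ k → (ext a ⊕ ext b) k ≡ φ r k)
  sameCoset⇒φ {a} {b} (rc , a-b≡u) = fromVec rc , fromVec-degree rc , agree
    where
    agree : ∀ k → (ext a ⊕ ext b) k ≡ φ (fromVec rc) k
    agree k with k ℕ.<? N
    ... | yes k<N = begin
      a i +ᶠ b i                  ≡⟨ cong (a i +ᶠ_) (sym (-x≡x (b i))) ⟩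
      a i +ᶠ -ᶠ b i               ≡⟨ a-b≡u i ⟩
      uElem rc i                  ≡⟨ uElem≡φ rc i ⟩
      φ (fromVec rc) (Fin.toℕ i)  ≡⟨ cong (φ (fromVec rc)) (FinP.toℕ-fromℕ< k<N) ⟩
      φ (fromVec rc) k            ∎
      where i = Fin.fromℕ< k<N
    ... | no k≮N = trans (+-identityˡ 0ᶠ) (sym (φ-beyond (fromVec-degree rc) k (ℕP.≮⇒≥ k≮N)))

  φ⇒sameCoset : ∀ {a b r} → DegreeBelow (suc (suc g)) r → (∀ k → (ext a ⊕ ext b) k ≡ φ r k) → SameCoset a b
  φ⇒sameCoset {a} {b} {r} deg agree = r ∘ Fin.toℕ , λ i → begin
    a i +ᶠ -ᶠ b i                                        ≡⟨ cong (a i +ᶠ_) (-x≡x (b i)) ⟩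
    a i +ᶠ b i                                           ≡⟨ sym (cong₂ _+ᶠ_ (ext-toℕ a i) (ext-toℕ b i)) ⟩
    (ext a ⊕ ext b) (Fin.toℕ i)                          ≡⟨ agree (Fin.toℕ i) ⟩
    φ r (Fin.toℕ i)                                      ≡⟨ φ-cong (sym ∘ fromVec-restrict deg) (Fin.toℕ i) ⟩
    φ (fromVec {suc (suc g)} (r ∘ Fin.toℕ)) (Fin.toℕ i)  ≡⟨ sym (uElem≡φ (r ∘ Fin.toℕ) i) ⟩
    uElem (r ∘ Fin.toℕ) i                                ∎

  Reduced : Coeffs → Set
  Reduced u = Normal u × DegreeBelow N u

  correction : Quot N → Coeffs
  correction w = proj₁ (normalise (ext w))

  correction-degree : ∀ w → DegreeBelow (suc (suc g)) (correction w)
  correction-degree w = proj₁ (proj₂ (normalise (ext w)))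

  canonical : Quot N → Coeffs
  canonical w = ext w ⊕ φ (correction w)

  canonical-reduced : ∀ w → Reduced (canonical w)
  canonical-reduced w = proj₂ (proj₂ (normalise (ext w))) , DegreeBelow-⊕ (fromVec-degree w) (φ-beyond (correction-degree w))

  sameCoset⇒canonical≗ : ∀ {a b} → SameCoset a b → ∀ k → canonical a k ≡ canonical b k
  sameCoset⇒canonical≗ {a} {b} a~b with r , deg , agree ← sameCoset⇒φ a~b =
    normal-unique (proj₁ (canonical-reduced a)) (proj₁ (canonical-reduced b))
                  (DegreeBelow-⊕ deg (DegreeBelow-⊕ (correction-degree a) (correction-degree b))) λ k → begin
      (ext a k +ᶠ φ ra k) +ᶠ (ext b k +ᶠ φ rb k)  ≡⟨ +-interchange _ _ _ _ ⟩
      (ext a k +ᶠ ext b k) +ᶠ (φ ra k +ᶠ φ rb k)  ≡⟨ cong₂ _+ᶠ_ (agree k) (sym (φ-⊕ ra rb k)) ⟩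
      φ r k +ᶠ φ (ra ⊕ rb) k                      ≡⟨ sym (φ-⊕ r (ra ⊕ rb) k) ⟩
      φ (r ⊕ (ra ⊕ rb)) k                         ∎
    where
    ra = correction a
    rb = correction b

  canonical≗⇒sameCoset : ∀ {a b} → (∀ k → canonical a k ≡ canonical b k) → SameCoset a b
  canonical≗⇒sameCoset {a} {b} eq = φ⇒sameCoset (DegreeBelow-⊕ (correction-degree a) (correction-degree b))
    λ k → trans (x+y≡z+w⇒x+z≡y+w (eq k)) (sym (φ-⊕ (correction a) (correction b) k))

  canonical-restrict : ∀ {u} → Reduced u → ∀ k → canonical (u ∘ Fin.toℕ) k ≡ u k
  canonical-restrict {u} (normal , deg) =
    normal-unique (proj₁ (canonical-reduced w)) normal (correction-degree w) λ k → begin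
      ext w k +ᶠ φ r k +ᶠ u k  ≡⟨ cong (λ z → z +ᶠ φ r k +ᶠ u k) (fromVec-restrict deg k) ⟩
      u k +ᶠ φ r k +ᶠ u k      ≡⟨ +-comm _ (u k) ⟩
      u k +ᶠ (u k +ᶠ φ r k)    ≡⟨ x+[x+y]≡y (u k) (φ r k) ⟩
      φ r k                    ∎
    where
    w = u ∘ Fin.toℕ
    r = correction w

  bit : Carrier → Bool
  bit x = does (x ≟ 0ᶠ)

  value : Bool → Carrier
  value true = 0ᶠ
  value false = c

  bit-value : ∀ b → bit (value b) ≡ b
  bit-value true = dec-true (0ᶠ ≟ 0ᶠ) refl
  bit-value false = dec-false (c ≟ 0ᶠ) c≢0

  value-bit : ∀ {x} → IsNormalAt d x → value (bit x) ≡ x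
  value-bit (inj₁ refl) = cong value (bit-value true)
  value-bit (inj₂ (_ , refl)) = cong value (bit-value false)

  read : Coeffs → Code
  read u = bit (u (pivot d)) , λ j → u (free (Fin.toℕ j))

  read-cong : ∀ {u u′} → (∀ k → u k ≡ u′ k) → read u ≈ read u′
  read-cong u≗u′ = mk≈ (cong bit (u≗u′ (pivot d))) (λ j → u≗u′ (free (Fin.toℕ j)))

  read-injective : ∀ {u u′} → Reduced u → Reduced u′ → read u ≈ read u′ → ∀ k → u k ≡ u′ k
  read-injective {u} {u′} (normal , deg) (normal′ , deg′) (mk≈ same-bit same-free) k with k ℕ.<? N
  ... | no k≮N = trans (deg k (ℕP.≮⇒≥ k≮N)) (sym (deg′ k (ℕP.≮⇒≥ k≮N)))
  ... | yes k<N with classify d≤G (subst (k <_) N≡1+G+G k<N)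
  ...   | inj₂ (j , j<G , refl) =
    subst (λ j′ → u (free j′) ≡ u′ (free j′)) (FinP.toℕ-fromℕ< j<G) (same-free (Fin.fromℕ< j<G))
  ...   | inj₁ (i , i≤G , refl) with i ℕ.≟ d
  ...     | no i≢d = trans (IsNormalAt-≢ i≢d (normal i i≤G)) (sym (IsNormalAt-≢ i≢d (normal′ i i≤G)))
  ...     | yes refl = begin
    u (pivot d)                 ≡⟨ sym (value-bit (normal d i≤G)) ⟩
    value (bit (u (pivot d)))   ≡⟨ cong value same-bit ⟩
    value (bit (u′ (pivot d)))  ≡⟨ value-bit (normal′ d i≤G) ⟩
    u′ (pivot d)                ∎

  pivotValue : Bool → ℕ → Carrier
  pivotValue b i with i ℕ.≟ d
  ... | yes _ = value b
  ... | no _ = 0ᶠ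

  pivotValue-normal : ∀ b i → IsNormalAt i (pivotValue b i)
  pivotValue-normal b i with i ℕ.≟ d
  pivotValue-normal true i | yes _ = inj₁ refl
  pivotValue-normal false i | yes i≡d = inj₂ (i≡d , refl)
  ... | no _ = inj₁ refl

  pivotValue-d : ∀ b → pivotValue b d ≡ value b
  pivotValue-d b with d ℕ.≟ d
  ... | yes _ = refl
  ... | no d≢d = contradiction refl d≢d

  fill : Code → ∀ {k} → Slot d≤G k → Carrier
  fill (b , _) (inj₁ (i , _ , _)) = pivotValue b i
  fill (_ , t) (inj₂ (j , j<G , _)) = t (Fin.fromℕ< j<G)

  build : Code → Coeffs
  build x k with k ℕ.<? N
  ... | yes k<N = fill x (classify d≤G (subst (k <_) N≡1+G+G k<N))
  ... | no _ = 0ᶠ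

  build-slot : ∀ x {k} → k < N → ∃ λ (s : Slot d≤G k) → build x k ≡ fill x s
  build-slot x {k} k<N with k ℕ.<? N
  ... | yes k<N′ = classify d≤G (subst (k <_) N≡1+G+G k<N′) , refl
  ... | no k≮N = contradiction k<N k≮N

  build-pivot : ∀ x {i} → i ≤ suc g → build x (pivot i) ≡ pivotValue (proj₁ x) i
  build-pivot x {i} i≤G
    with s , build≡fill ← build-slot x (subst (pivot i <_) (sym N≡1+G+G) (pivot-bound d≤G i≤G))
    = trans build≡fill (fill-pivot s)
    where
    fill-pivot : (s : Slot d≤G (pivot i)) → fill x s ≡ pivotValue (proj₁ x) i
    fill-pivot (inj₁ (i′ , _ , eq)) = cong (pivotValue (proj₁ x)) (pivot-injective {i′} {i} eq)
    fill-pivot (inj₂ (j , _ , eq)) = contradiction (sym eq) (pivot≢free i j)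

  build-free : ∀ x j → build x (free (Fin.toℕ j)) ≡ proj₂ x j
  build-free x j
    with s , build≡fill ← build-slot x (subst (free (Fin.toℕ j) <_) (sym N≡1+G+G) (free-bound d≤G (FinP.toℕ<n j)))
    = trans build≡fill (fill-free s)
    where
    fill-free : (s : Slot d≤G (free (Fin.toℕ j))) → fill x s ≡ proj₂ x j
    fill-free (inj₁ (i , _ , eq)) = contradiction eq (pivot≢free i _)
    fill-free (inj₂ (j′ , j′<G , eq)) =
      cong (proj₂ x) (FinP.toℕ-injective (trans (FinP.toℕ-fromℕ< j′<G) (free-injective {j′} {Fin.toℕ j} eq)))

  build-reduced : ∀ x → Reduced (build x)
  build-reduced x = (λ i i≤G → subst (IsNormalAt i) (sym (build-pivot x i≤G)) (pivotValue-normal (proj₁ x) i)) , beyond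
    where
    beyond : DegreeBelow N (build x)
    beyond k N≤k with k ℕ.<? N
    ... | yes k<N = contradiction N≤k (ℕP.<⇒≱ k<N)
    ... | no _ = refl

  read-build : ∀ x → read (build x) ≈ x
  read-build x =
    mk≈ (trans (cong bit (trans (build-pivot x d≤G) (pivotValue-d (proj₁ x)))) (bit-value (proj₁ x))) (build-free x)

  invariant : Quot N → Code
  invariant w = read (canonical w)

  invariant-surjective : ∀ x → ∃ λ w → invariant w ≈ x
  invariant-surjective x = build x ∘ Fin.toℕ , ≈-trans (read-cong (canonical-restrict (build-reduced x))) (read-build x)

  classOf : Quot N → Fin (2 * m ^ suc g)
  classOf = encode ∘ invariant

  classOf-surjective : ∀ z → ∃ λ w → classOf w ≡ z
  classOf-surjective z =
    Product.map₂ (λ invariant≈ → trans (encode-cong invariant≈) (encode-decode z)) (invariant-surjective (decode z))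

  classOf-sound : ∀ a b → classOf a ≡ classOf b → SameCoset a b
  classOf-sound a b eq =
    canonical≗⇒sameCoset (read-injective (canonical-reduced a) (canonical-reduced b)
                                         (encode-injective {invariant a} {invariant b} eq))

  classOf-complete : ∀ {a b} → SameCoset a b → classOf a ≡ classOf b
  classOf-complete = encode-cong ∘ read-cong ∘ sameCoset⇒canonical≗

  quotientHasSize : QuotientHasSize g F d vc (2 * m ^ suc g)
  quotientHasSize = classOf , classOf-surjective , λ a b → classOf-sound a b , classOf-complete

2*[2^n]^[1+g]≡2^[[g+1]n+1] : ∀ g n → 2 * (2 ^ n) ^ suc g ≡ 2 ^ ((g + 1) * n + 1)
2*[2^n]^[1+g]≡2^[[g+1]n+1] g n = trans (cong (2 *_) (ℕP.^-*-assoc 2 n (suc g))) (cong (2 ^_) (exponent g n))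
  where
  exponent : ∀ g n → suc (n * suc g) ≡ (g + 1) * n + 1
  exponent = solve-∀

lemma4p6 : (g n : ℕ) → 1 ≤ g → 1 ≤ n → (F : Field) → HasOrder F (2 ^ n) → (d : ℕ) → d ≤ g + 1 → (vc : Fin d → Field.Carrier F) → QuotientHasSize g F d vc (2 ^ ((g + 1) * n + 1))
lemma4p6 g n _ _ F F↔Fin d d≤g+1 vc =
  subst (QuotientHasSize g F d vc) (2*[2^n]^[1+g]≡2^[[g+1]n+1] g n)
        (Quotient.quotientHasSize g F F↔Fin (FiniteField.characteristic-2 F F↔Fin n refl) d d≤G vc)
  where
  d≤G = subst (d ≤_) (ℕP.+-comm g 1) d≤g+1
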